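{- Let $\mathcal T=(T,\tau)$ be a countable topological $T_0$ space with countable basis $\mathcal B$, total numbering $B$ of $\mathcal B$, and strong inclusion $\prec_B$ with respect to which $\mathcal B$ is a strong basis. Suppose $\prec_B$ is computably enumerable and $x$ is an acceptable numbering of $T$. Then for any numbering $x'$ of $T$, $x'$ is acceptable if and only if $x$ and $x'$ are equivalent.
   Context: Notation: $P^{(n)}$ ($R^{(n)}$) denotes the $n$-ary partial (total) computable functions; $\varphi$ is a Gödel numbering of $P^{(1)}$; $\langle\cdot,\cdot\rangle$ is a computable pairing function. A numbering of a set $S$ is a partial map from $\omega$ onto $S$, $n\mapsto\nu_n$. For numberings $\nu,\kappa$ of $S$: $\nu\le\kappa$ if there is $g\in P^{(1)}$ defined on $\mathrm{dom}(\nu)$ with $g(\mathrm{dom}(\nu))\subseteq\mathrm{dom}(\kappa)$ and $\nu_m=\kappa_{g(m)}$ for all $m\in\mathrm{dom}(\nu)$; $\nu$ and $\kappa$ are equivalent if $\nu\le\kappa$ and $\kappa\le\nu$. $B$ ($n\mapsto B_n$) is a total numbering of $\mathcal B$. A transitive relation $\prec_B$ on $\omega$ is a strong inclusion if $m\prec_B n$ implies $B_m\subseteq B_n$; $\mathcal B$ is a strong basis if whenever $z\in B_m\cap B_n$ there is $a$ with $z\in B_a$, $a\prec_B m$ and $a\prec_B n$. A strong base of a filter $\mathcal H$ is a nonempty set $\mathcal F\subseteq\mathcal H$ of basic open sets such that (i) for $B_m,B_n\in\mathcal F$ there is $a$ with $B_a\in\mathcal F$, $a\prec_B m$, $a\prec_B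 n$; (ii) for $B_m\in\mathcal H$ there is $a$ with $B_a\in\mathcal F$, $a\prec_B m$. An enumeration $(B_{f(a)})_a$ is normed if $f(a+1)\prec_B f(a)$ for all $a$; it is computable if $f$ is computable, any Gödel number of $f$ being an index; it converges to $y$ if it is normed and enumerates a strong base of the neighbourhood filter of $y$. A numbering $x$ of $T$ is computable if there is a c.e. $L\subseteq\omega$ with $\langle i,n\rangle\in L\iff x_i\in B_n$ for all $i\in\mathrm{dom}(x)$, $n\in\omega$. $x$ allows effective limit passing if there is $pt\in P^{(1)}$ such that whenever $m$ is an index of a normed computable enumeration of basic open sets converging to $y\in T$, $pt(m)$ is defined, lies in $\mathrm{dom}(x)$, and $x_{pt(m)}=y$. $x$ is acceptable if it is computable and allows effective limit passing (both notions taken with respect to the fixed $B$ and $\prec_B$). -}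

module Defs where

open import Level using (0ℓ) renaming (suc to lsuc)
open import Data.Nat using (ℕ; zero; suc; _<_)
open import Data.Fin using (Fin)
open import Data.Vec using (Vec; []; _∷_; lookup)
open import Data.Product using (Σ; ∃; ∃-syntax; _×_; _,_)
open import Data.Sum using (_⊎_)
open import Relation.Nullary using (¬_)
open import Relation.Unary using (Pred; _⊆_; _∈_)
open import Relation.Binary.PropositionalEquality using (_≡_; _≢_)
open import Function.Bundles using (_⇔_)

-- Partial computable functions: μ-recursive codes of arity n and their
-- (partial, functional) evaluation relation.  P^(n) = graphs of codes.

data Code : ℕ → Set where
  zeroᶜ : ∀ {n} → Code n
  succᶜ : Code 1
  projᶜ : ∀ {n} → Fin n → Code n
  compᶜ : ∀ {m n} → Code m → Vec (Code n) m → Code n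
  precᶜ : ∀ {n} → Code n → Code (suc (suc n)) → Code (suc n)
  muᶜ   : ∀ {n} → Code (suc n) → Code n

data Eval : ∀ {n} → Code n → Vec ℕ n → ℕ → Set
data EvalAll : ∀ {m n} → Vec (Code n) m → Vec ℕ n → Vec ℕ m → Set

data Eval where
  ev-zero  : ∀ {n} {xs : Vec ℕ n} → Eval zeroᶜ xs 0
  ev-succ  : ∀ {x} → Eval succᶜ (x ∷ []) (suc x)
  ev-proj  : ∀ {n} {i : Fin n} {xs} → Eval (projᶜ i) xs (lookup xs i)
  ev-comp  : ∀ {m n} {f : Code m} {gs : Vec (Code n) m} {xs ys y} →
             EvalAll gs xs ys → Eval f ys y → Eval (compᶜ f gs) xs y
  ev-prec0 : ∀ {n} {f : Code n} {g xs y} →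
             Eval f xs y → Eval (precᶜ f g) (0 ∷ xs) y
  ev-precS : ∀ {n} {f : Code n} {g k xs r y} →
             Eval (precᶜ f g) (k ∷ xs) r → Eval g (k ∷ r ∷ xs) y →
             Eval (precᶜ f g) (suc k ∷ xs) y
  ev-mu    : ∀ {n} {f : Code (suc n)} {xs y} →
             Eval f (y ∷ xs) 0 →
             (∀ k → k < y → ∃[ v ] Eval f (k ∷ xs) (suc v)) →
             Eval (muᶜ f) xs y

data EvalAll where
  []  : ∀ {n} {xs : Vec ℕ n} → EvalAll [] xs []
  _∷_ : ∀ {m n} {g : Code n} {gs : Vec (Code n) m} {xs y ys} →
        Eval g xs y → EvalAll gs xs ys → EvalAll (g ∷ gs) xs (y ∷ ys)

CE : Pred ℕ 0ℓ → Set
CE L = Σ (Code 1) λ c → ∀ k → L k ⇔ (∃[ v ] Eval c (k ∷ []) v)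

-- Gödel numbering φ of P^(1), given by its graph φ e a v  ("φ_e(a) = v").
-- (Rogers) a numbering of P^(1) with computable universal function and
-- the s-m-n property.

record IsGödelNumbering (φ : ℕ → ℕ → ℕ → Set) : Set where
  field
    each-computable : ∀ e → Σ (Code 1) λ c → ∀ a v → φ e a v ⇔ Eval c (a ∷ []) v
    onto            : ∀ (c : Code 1) → ∃[ e ] (∀ a v → φ e a v ⇔ Eval c (a ∷ []) v)
    universal       : Σ (Code 2) λ u → ∀ e a v → φ e a v ⇔ Eval u (e ∷ a ∷ []) v
    smn             : ∀ (c : Code 2) → Σ (Code 1) λ s →
                      ∀ i → ∃[ j ] (Eval s (i ∷ []) j ×
                                    (∀ a v → φ j a v ⇔ Eval c (i ∷ a ∷ []) v))

record IsComputablePairing (pair : ℕ → ℕ → ℕ) : Set where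
  field
    computable : Σ (Code 2) λ c → ∀ a b v → Eval c (a ∷ b ∷ []) v ⇔ (pair a b ≡ v)
    injective  : ∀ a b c d → pair a b ≡ pair c d → (a ≡ c × b ≡ d)
    surjective : ∀ k → ∃[ a ] ∃[ b ] (pair a b ≡ k)

-- Numberings: partial surjective maps ω ⇀ S, given by their graph.

record Numbering (S : Set) : Set₁ where
  field
    _↦_        : ℕ → S → Set                  -- i ↦ s  means  i ∈ dom ν and ν_i = s
    functional : ∀ {i s t} → i ↦ s → i ↦ t → s ≡ t
    onto       : ∀ s → ∃[ i ] (i ↦ s)

open Numbering public

_≤ₙ_ : ∀ {S} → Numbering S → Numbering S → Set
ν ≤ₙ κ = Σ (Code 1) λ g → ∀ m s → _↦_ ν m s → ∃[ k ] (Eval g (m ∷ []) k × _↦_ κ k s)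

Equivalent : ∀ {S} → Numbering S → Numbering S → Set
Equivalent ν κ = (ν ≤ₙ κ) × (κ ≤ₙ ν)

Countable : Set → Set
Countable T = Σ (T → ℕ) λ f → ∀ y z → f y ≡ f z → y ≡ z

module Space (φ : ℕ → ℕ → ℕ → Set) (pair : ℕ → ℕ → ℕ)
             (T : Set) (B : ℕ → Pred T 0ℓ) (_≺_ : ℕ → ℕ → Set) where

  SameSet : Pred T 0ℓ → Pred T 0ℓ → Set
  SameSet U V = (U ⊆ V) × (V ⊆ U)

  Open : Pred T 0ℓ → Set
  Open U = ∀ y → U y → ∃[ n ] (B n y × B n ⊆ U)

  IsBasis : Set
  IsBasis = (∀ y → ∃[ n ] B n y)
          × (∀ m n y → B m y → B n y →
               ∃[ a ] (B a y × B a ⊆ B m × B a ⊆ B n))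

  IsT0 : Set₁
  IsT0 = ∀ y z → y ≢ z → Σ (Pred T 0ℓ) λ U →
           Open U × ((U y × ¬ U z) ⊎ (U z × ¬ U y))

  Transitive≺ : Set
  Transitive≺ = ∀ {k m n} → k ≺ m → m ≺ n → k ≺ n

  IsStrongInclusion : Set
  IsStrongInclusion = Transitive≺ × (∀ m n → m ≺ n → B m ⊆ B n)

  IsStrongBasis : Set
  IsStrongBasis = ∀ z m n → B m z → B n z → ∃[ a ] (B a z × a ≺ m × a ≺ n)

  ≺-CE : Set₁
  ≺-CE = Σ (Pred ℕ 0ℓ) λ L → CE L × (∀ m n → L (pair m n) ⇔ (m ≺ n))

  Nbhd : T → Pred (Pred T 0ℓ) (lsuc 0ℓ)
  Nbhd y U = Σ (Pred T 0ℓ) λ V → Open V × V y × V ⊆ U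

  IsStrongBase : Pred (Pred T 0ℓ) 0ℓ → Pred (Pred T 0ℓ) (lsuc 0ℓ) → Set₁
  IsStrongBase 𝓕 𝓗 =
      (Σ (Pred T 0ℓ) λ U → 𝓕 U)
    × (∀ U → 𝓕 U → 𝓗 U)
    × (∀ U → 𝓕 U → ∃[ n ] SameSet U (B n))
    × (∀ m n → 𝓕 (B m) → 𝓕 (B n) → ∃[ a ] (𝓕 (B a) × a ≺ m × a ≺ n))
    × (∀ m → 𝓗 (B m) → ∃[ a ] (𝓕 (B a) × a ≺ m))

  Enumerated : (ℕ → ℕ) → Pred (Pred T 0ℓ) 0ℓ
  Enumerated f U = ∃[ a ] SameSet U (B (f a))

  Normed : (ℕ → ℕ) → Set
  Normed f = ∀ a → f (suc a) ≺ f a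

  ConvergesTo : (ℕ → ℕ) → T → Set₁
  ConvergesTo f y = Normed f × IsStrongBase (Enumerated f) (Nbhd y)

  IndexOfConvergent : ℕ → T → Set₁
  IndexOfConvergent m y = Σ (ℕ → ℕ) λ f →
    (∀ a v → φ m a v ⇔ (f a ≡ v)) × ConvergesTo f y

  ComputableNumbering : Numbering T → Set₁
  ComputableNumbering x = Σ (Pred ℕ 0ℓ) λ L → CE L ×
    (∀ i y n → _↦_ x i y → (L (pair i n) ⇔ B n y))

  EffectiveLimitPassing : Numbering T → Set₁
  EffectiveLimitPassing x = Σ (Code 1) λ pt →
    ∀ m y → IndexOfConvergent m y → ∃[ v ] (Eval pt (m ∷ []) v × _↦_ x v y)

  Acceptable : Numbering T → Set₁
  Acceptable x = ComputableNumbering x × EffectiveLimitPassing x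

module Submission where

-- The core is the reduction lemma `computable≤limitPassing`: a computable
-- numbering ν reduces to every numbering κ allowing effective limit passing.
-- For ν_i = y we enumerate in stages the basic sets containing y and the
-- relation ≺, and build uniformly in i a normed sequence that eventually
-- lies ≺-below each neighbourhood of y, hence converges to y; s-m-n computes
-- its index from i, and κ's limit passing turns that into a κ-name of y.
-- The converse uses two transfer lemmas: limit passing moves up along ≤,
-- computability moves down along ≤.

open import Defs
open import Level using (0ℓ)
open import Data.Nat using (ℕ; zero; suc; _<_; _≤_; s≤s; pred; _⊔_; _+_; _∸_; s≤s⁻¹)
open import Data.Nat.Properties
open import Data.Fin using (Fin; _↑ʳ_; #_) renaming (zero to fzero; suc to fsuc)
open import Data.Vec using (Vec; []; _∷_; head; tail; lookup; tabulate; map; _++_)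
open import Data.Vec.Properties using (lookup-++ʳ; tabulate∘lookup; tabulate-cong; map-∘; map-id)
open import Data.Product using (Σ; ∃; ∃-syntax; _×_; _,_; proj₁; proj₂)
open import Data.Sum using (_⊎_; inj₁; inj₂)
open import Data.Empty using (⊥-elim)
open import Function using (_∘_)
open import Function.Bundles using (_⇔_; mk⇔; Equivalence)
open import Relation.Binary.PropositionalEquality
open import Relation.Binary.Definitions using (tri<; tri≈; tri>)
open import Relation.Nullary using (¬_; yes; no)
open import Relation.Unary using (Pred)

open Equivalence using (to; from)

-- For μ: a smaller zero of the minimised function would
-- contradict the other derivation's guarantee of positive values below it.
mutual
  eval-functional : ∀ {n} {c : Code n} {xs v w} → Eval c xs v → Eval c xs w → v ≡ w
  eval-functional ev-zero ev-zero = refl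
  eval-functional ev-succ ev-succ = refl
  eval-functional ev-proj ev-proj = refl
  eval-functional (ev-comp as b) (ev-comp as′ b′) with evalAll-functional as as′
  ... | refl = eval-functional b b′
  eval-functional (ev-prec0 a) (ev-prec0 a′) = eval-functional a a′
  eval-functional (ev-precS a b) (ev-precS a′ b′) with eval-functional a a′
  ... | refl = eval-functional b b′
  eval-functional (ev-mu {y = y} a h) (ev-mu {y = y′} a′ h′) with <-cmp y y′
  ... | tri≈ _ y≡y′ _ = y≡y′
  ... | tri< y<y′ _ _ with eval-functional a (proj₂ (h′ y y<y′))
  ...   | ()
  eval-functional (ev-mu a h) (ev-mu a′ h′) | tri> _ _ y′<y with eval-functional a′ (proj₂ (h _ y′<y))
  ...   | ()

  evalAll-functional : ∀ {m n} {gs : Vec (Code n) m} {xs vs ws} →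
                       EvalAll gs xs vs → EvalAll gs xs ws → vs ≡ ws
  evalAll-functional [] [] = refl
  evalAll-functional (a ∷ as) (b ∷ bs) = cong₂ _∷_ (eval-functional a b) (evalAll-functional as bs)

ifZero : ℕ → ℕ → ℕ → ℕ
ifZero zero    a b = a
ifZero (suc _) a b = b

-- Stage-bounded evaluation.  `run c s xs` is 0 if c has not halted on xs
-- at stage s, and suc v if it has halted with value v; the stage bounds
-- every μ-search.  It is computable in (s, xs) (`runCode` below) and
-- converges to Eval (`run-sound`, `run-complete`): this is what lets c.e.
-- sets be enumerated in stages.

whenAllHalted : ∀ {m} → Vec ℕ m → ℕ → ℕ
whenAllHalted []       e = e
whenAllHalted (r ∷ rs) e = ifZero r 0 (whenAllHalted rs e)

-- One step of a μ-search at candidate j with stage result r: not halted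
-- gives up (1), value 0 ends the search at j (suc (suc j)), a positive
-- value continues (0).
muStep : ℕ → ℕ → ℕ
muStep r j = ifZero r 1 (ifZero (pred r) (suc (suc j)) 0)

mutual
  run : ∀ {n} → Code n → ℕ → Vec ℕ n → ℕ
  run zeroᶜ        s xs       = 1
  run succᶜ        s (x ∷ []) = suc (suc x)
  run (projᶜ i)    s xs       = suc (lookup xs i)
  run (compᶜ f gs) s xs       = whenAllHalted (runAll gs s xs) (run f s (map pred (runAll gs s xs)))
  run (precᶜ f g)  s (k ∷ xs) = runPrec f g s xs k
  run (muᶜ f)      s xs       = pred (runMu f s xs s)

  runAll : ∀ {m n} → Vec (Code n) m → ℕ → Vec ℕ n → Vec ℕ m
  runAll []       s xs = []
  runAll (g ∷ gs) s xs = run g s xs ∷ runAll gs s xs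

  runPrec : ∀ {n} → Code n → Code (suc (suc n)) → ℕ → Vec ℕ n → ℕ → ℕ
  runPrec f g s xs zero    = run f s xs
  runPrec f g s xs (suc k) = ifZero (runPrec f g s xs k) 0 (run g s (k ∷ pred (runPrec f g s xs k) ∷ xs))

  -- State of the μ-search after the candidates below j: 0 while all of
  -- them halted with positive values, afterwards the final answer + 1.
  runMu : ∀ {n} → Code (suc n) → ℕ → Vec ℕ n → ℕ → ℕ
  runMu f s xs zero    = 0
  runMu f s xs (suc j) = ifZero (runMu f s xs j) (muStep (run f s (j ∷ xs)) j) (runMu f s xs j)

HaltsPositive : ∀ {n} → Code (suc n) → ℕ → Vec ℕ n → ℕ → Set
HaltsPositive f s xs k = ∃[ r ] (run f s (k ∷ xs) ≡ suc (suc r))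

map-pred-suc : ∀ {m} (ys : Vec ℕ m) → map pred (map suc ys) ≡ ys
map-pred-suc ys = trans (sym (map-∘ pred suc ys)) (map-id ys)

whenAllHalted-sound : ∀ {m} (rs : Vec ℕ m) e v → whenAllHalted rs e ≡ suc v →
                      (e ≡ suc v) × ∃[ ys ] (rs ≡ map suc ys)
whenAllHalted-sound []           e v e≡ = e≡ , [] , refl
whenAllHalted-sound (zero ∷ rs)  e v ()
whenAllHalted-sound (suc r ∷ rs) e v e≡ with whenAllHalted-sound rs e v e≡
... | e≡v , ys , refl = e≡v , r ∷ ys , refl

whenAllHalted-halted : ∀ {m} (ys : Vec ℕ m) e → whenAllHalted (map suc ys) e ≡ e
whenAllHalted-halted []       e = refl
whenAllHalted-halted (y ∷ ys) e = whenAllHalted-halted ys e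

runMu-searching : ∀ {n} (f : Code (suc n)) s xs j → runMu f s xs j ≡ 0 →
                  ∀ k → k < j → HaltsPositive f s xs k
runMu-searching f s xs (suc j) eq k k<1+j with runMu f s xs j in state
runMu-searching f s xs (suc j) () k k<1+j | suc _
... | zero with run f s (j ∷ xs) in rj
runMu-searching f s xs (suc j) () k k<1+j | zero | zero
runMu-searching f s xs (suc j) () k k<1+j | zero | suc zero
... | suc (suc r) with m<1+n⇒m<n∨m≡n k<1+j
... | inj₁ k<j = runMu-searching f s xs j state k k<j
... | inj₂ refl = r , rj

runMu-found : ∀ {n} (f : Code (suc n)) s xs j y → runMu f s xs j ≡ suc (suc y) →
              (run f s (y ∷ xs) ≡ 1) × (∀ k → k < y → HaltsPositive f s xs k)
runMu-found f s xs (suc j) y eq with runMu f s xs j in state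
... | suc z = runMu-found f s xs j y (trans state eq)
... | zero with run f s (j ∷ xs) in rj
runMu-found f s xs (suc j) y () | zero | zero
runMu-found f s xs (suc j) .j refl | zero | suc zero = rj , runMu-searching f s xs j state
runMu-found f s xs (suc j) y () | zero | suc (suc r)

runMu-searching⁻¹ : ∀ {n} (f : Code (suc n)) s xs j → (∀ k → k < j → HaltsPositive f s xs k) → runMu f s xs j ≡ 0
runMu-searching⁻¹ f s xs zero    h = refl
runMu-searching⁻¹ f s xs (suc j) h
  rewrite runMu-searching⁻¹ f s xs j (λ k k<j → h k (m<n⇒m<1+n k<j)) | proj₂ (h j ≤-refl) = refl

runMu-stable : ∀ {n} (f : Code (suc n)) s xs j z → runMu f s xs j ≡ suc z → ∀ d → runMu f s xs (d + j) ≡ suc z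
runMu-stable f s xs j z e zero    = e
runMu-stable f s xs j z e (suc d) rewrite runMu-stable f s xs j z e d = refl

mutual
  run-sound : ∀ {n} (c : Code n) s xs v → run c s xs ≡ suc v → Eval c xs v
  run-sound zeroᶜ s xs .0 refl = ev-zero
  run-sound succᶜ s (x ∷ []) .(suc x) refl = ev-succ
  run-sound (projᶜ i) s xs .(lookup xs i) refl = ev-proj
  run-sound (compᶜ f gs) s xs v eq with whenAllHalted-sound (runAll gs s xs) _ v eq
  ... | f-halts , ys , gs-halt =
    ev-comp (runAll-sound gs s xs ys gs-halt)
            (run-sound f s ys v (trans (cong (run f s) (sym (trans (cong (map pred) gs-halt) (map-pred-suc ys)))) f-halts))
  run-sound (precᶜ f g) s (k ∷ xs) v eq = runPrec-sound f g s xs k v eq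
  run-sound (muᶜ f) s xs v eq with runMu f s xs s in state
  run-sound (muᶜ f) s xs v () | zero
  run-sound (muᶜ f) s xs v () | suc zero
  run-sound (muᶜ f) s xs .y refl | suc (suc y) with runMu-found f s xs s y state
  ... | zero-at-y , positive-below =
    ev-mu (run-sound f s (y ∷ xs) 0 zero-at-y)
          (λ k k<y → let r , e = positive-below k k<y in r , run-sound f s (k ∷ xs) _ e)

  runAll-sound : ∀ {m n} (gs : Vec (Code n) m) s xs ys → runAll gs s xs ≡ map suc ys → EvalAll gs xs ys
  runAll-sound []       s xs []       eq = []
  runAll-sound (g ∷ gs) s xs (y ∷ ys) eq =
    run-sound g s xs y (cong head eq) ∷ runAll-sound gs s xs ys (cong tail eq)

  runPrec-sound : ∀ {n} (f : Code n) g s xs k v → runPrec f g s xs k ≡ suc v → Eval (precᶜ f g) (k ∷ xs) v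
  runPrec-sound f g s xs zero    v eq = ev-prec0 (run-sound f s xs v eq)
  runPrec-sound f g s xs (suc k) v eq with runPrec f g s xs k in previous
  runPrec-sound f g s xs (suc k) v () | zero
  ... | suc r = ev-precS (runPrec-sound f g s xs k r previous) (run-sound g s (k ∷ r ∷ xs) v eq)

Eventually : (ℕ → Set) → Set
Eventually P = ∃[ s₀ ] (∀ s → s₀ ≤ s → P s)

eventually-both : ∀ {P Q : ℕ → Set} → Eventually P → Eventually Q → Eventually (λ s → P s × Q s)
eventually-both (a , p) (b , q) =
  a ⊔ b , λ s le → p s (≤-trans (m≤m⊔n a b) le) , q s (≤-trans (m≤n⊔m a b) le)

eventually-below : ∀ (P : ℕ → ℕ → Set) y → (∀ k → k < y → Eventually (P k)) →
                   Eventually (λ s → ∀ k → k < y → P k s)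
eventually-below P zero    h = 0 , λ s _ k ()
eventually-below P (suc y) h
  with eventually-both (eventually-below P y (λ k k<y → h k (m<n⇒m<1+n k<y))) (h y ≤-refl)
... | s₀ , q = s₀ , λ s le k k<1+y → upto-y k<1+y s le
  where
    upto-y : ∀ {k} → k < suc y → ∀ s → s₀ ≤ s → P k s
    upto-y k<1+y s le with m<1+n⇒m<n∨m≡n k<1+y
    ... | inj₁ k<y  = proj₁ (q s le) _ k<y
    ... | inj₂ refl = proj₂ (q s le)

mutual
  run-complete : ∀ {n} {c : Code n} {xs v} → Eval c xs v → Eventually (λ s → run c s xs ≡ suc v)
  run-complete ev-zero = 0 , λ s _ → refl
  run-complete {xs = x ∷ []} ev-succ = 0 , λ s _ → refl
  run-complete ev-proj = 0 , λ s _ → refl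
  run-complete {c = compᶜ f gs} {xs = xs} (ev-comp {ys = ys} as b)
    with eventually-both (runAll-complete as) (run-complete b)
  ... | s₀ , q = s₀ , λ s le → let gs-halt , f-halts = q s le in begin
        whenAllHalted (runAll gs s xs) (run f s (map pred (runAll gs s xs)))
          ≡⟨ cong (λ w → whenAllHalted w (run f s (map pred w))) gs-halt ⟩
        whenAllHalted (map suc ys) (run f s (map pred (map suc ys)))
          ≡⟨ whenAllHalted-halted ys _ ⟩
        run f s (map pred (map suc ys))
          ≡⟨ cong (run f s) (map-pred-suc ys) ⟩
        run f s ys
          ≡⟨ f-halts ⟩
        _ ∎
    where open ≡-Reasoning
  run-complete (ev-prec0 a) = run-complete a
  run-complete {c = precᶜ f g} {xs = suc k ∷ xs} (ev-precS a b)
    with eventually-both (run-complete a) (run-complete b)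
  ... | s₀ , q = s₀ , λ s le → let prev , step = q s le in
    trans (cong (λ w → ifZero w 0 (run g s (k ∷ pred w ∷ xs))) prev) step
  run-complete {c = muᶜ f} {xs = xs} (ev-mu {y = y} zero-at-y positive)
    with eventually-both (run-complete zero-at-y)
           (eventually-below (λ k s → HaltsPositive f s xs k) y
              (λ k k<y → let r , e = positive k k<y
                             s₀ , q = run-complete e
                         in s₀ , λ s le → r , q s le))
  ... | s₀ , q = suc y ⊔ s₀ , λ s le →
    cong pred (found s (≤-trans (m≤m⊔n (suc y) s₀) le) (q s (≤-trans (m≤n⊔m (suc y) s₀) le)))
    where
      found : ∀ s → suc y ≤ s → (run f s (y ∷ xs) ≡ 1) × (∀ k → k < y → HaltsPositive f s xs k) →
              runMu f s xs s ≡ suc (suc y)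
      found s y<s (halts-at-y , below) =
        subst (λ t → runMu f s xs t ≡ suc (suc y)) (m∸n+n≡m y<s)
              (runMu-stable f s xs (suc y) (suc y) reached (s ∸ suc y))
        where
          reached : runMu f s xs (suc y) ≡ suc (suc y)
          reached rewrite runMu-searching⁻¹ f s xs y below | halts-at-y = refl

  runAll-complete : ∀ {m n} {gs : Vec (Code n) m} {xs ys} → EvalAll gs xs ys →
                    Eventually (λ s → runAll gs s xs ≡ map suc ys)
  runAll-complete [] = 0 , λ s _ → refl
  runAll-complete (a ∷ as) with eventually-both (run-complete a) (runAll-complete as)
  ... | s₀ , q = s₀ , λ s le → cong₂ _∷_ (proj₁ (q s le)) (proj₂ (q s le))

predCode : Code 1
predCode = precᶜ zeroᶜ (projᶜ fzero)

pred-eval : ∀ x → Eval predCode (x ∷ []) (pred x)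
pred-eval zero    = ev-prec0 ev-zero
pred-eval (suc x) = ev-precS (pred-eval x) ev-proj

ifZeroCode : Code 3
ifZeroCode = precᶜ (projᶜ fzero) (projᶜ (# 3))

ifZero-eval : ∀ c a b → Eval ifZeroCode (c ∷ a ∷ b ∷ []) (ifZero c a b)
ifZero-eval zero    a b = ev-prec0 ev-proj
ifZero-eval (suc c) a b = ev-precS (ifZero-eval c a b) ev-proj

oneCode : ∀ {n} → Code n
oneCode = compᶜ succᶜ (zeroᶜ ∷ [])

restCodes : ∀ k n → Vec (Code (k + n)) n
restCodes k n = tabulate (projᶜ ∘ (k ↑ʳ_))

restCodes-eval : ∀ k {n} (ys : Vec ℕ k) (xs : Vec ℕ n) → EvalAll (restCodes k n) (ys ++ xs) xs
restCodes-eval k {n} ys xs =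
  subst (EvalAll (restCodes k _) (ys ++ xs))
        (trans (tabulate-cong (lookup-++ʳ ys xs)) (tabulate∘lookup xs))
        (projections (k ↑ʳ_))
  where
    projections : ∀ {m} (h : Fin m → Fin (k + n)) → EvalAll (tabulate (projᶜ ∘ h)) (ys ++ xs) (tabulate (lookup (ys ++ xs) ∘ h))
    projections {zero}  h = []
    projections {suc m} h = ev-proj ∷ projections (h ∘ fsuc)

whenAllHaltedCode : ∀ {m n} → Vec (Code n) m → Code n → Code n
whenAllHaltedCode []       e = e
whenAllHaltedCode (r ∷ rs) e = compᶜ ifZeroCode (r ∷ zeroᶜ ∷ whenAllHaltedCode rs e ∷ [])

whenAllHalted-eval : ∀ {m n} {rs : Vec (Code n) m} {zs vs e w} → EvalAll rs zs vs → Eval e zs w →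
                     Eval (whenAllHaltedCode rs e) zs (whenAllHalted vs w)
whenAllHalted-eval [] e = e
whenAllHalted-eval {vs = v ∷ vs} {w = w} (r ∷ rs) e =
  ev-comp (r ∷ ev-zero ∷ whenAllHalted-eval rs e ∷ []) (ifZero-eval v 0 (whenAllHalted vs w))

predCodes : ∀ {m n} → Vec (Code n) m → Vec (Code n) m
predCodes []       = []
predCodes (c ∷ cs) = compᶜ predCode (c ∷ []) ∷ predCodes cs

predCodes-eval : ∀ {m n} {cs : Vec (Code n) m} {zs vs} → EvalAll cs zs vs → EvalAll (predCodes cs) zs (map pred vs)
predCodes-eval [] = []
predCodes-eval {vs = v ∷ _} (c ∷ cs) = ev-comp (c ∷ []) (pred-eval v) ∷ predCodes-eval cs

mutual
  runCode : ∀ {n} → Code n → Code (suc n)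
  runCode zeroᶜ        = oneCode
  runCode succᶜ        = compᶜ succᶜ (compᶜ succᶜ (projᶜ (# 1) ∷ []) ∷ [])
  runCode (projᶜ i)    = compᶜ succᶜ (projᶜ (fsuc i) ∷ [])
  runCode (compᶜ f gs) = whenAllHaltedCode (runCodes gs) (compᶜ (runCode f) (projᶜ fzero ∷ predCodes (runCodes gs)))
  runCode {suc n} (precᶜ f g) = compᶜ (precᶜ (runCode f) (runPrecStep g)) (projᶜ (# 1) ∷ projᶜ (# 0) ∷ restCodes 2 n)
  runCode {n} (muᶜ f)  =
    compᶜ predCode (compᶜ (precᶜ zeroᶜ (runMuStep f)) (projᶜ (# 0) ∷ projᶜ (# 0) ∷ restCodes 1 n) ∷ [])

  runCodes : ∀ {m n} → Vec (Code n) m → Vec (Code (suc n)) m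
  runCodes []       = []
  runCodes (g ∷ gs) = runCode g ∷ runCodes gs

  -- arguments (k ∷ r ∷ s ∷ xs), r = runPrec at k
  runPrecStep : ∀ {n} → Code (suc (suc n)) → Code (suc (suc (suc n)))
  runPrecStep {n} g =
    compᶜ ifZeroCode (projᶜ (# 1) ∷ zeroᶜ
      ∷ compᶜ (runCode g) (projᶜ (# 2) ∷ projᶜ (# 0) ∷ compᶜ predCode (projᶜ (# 1) ∷ []) ∷ restCodes 3 n) ∷ [])

  -- arguments (j ∷ a ∷ s ∷ xs): the candidate's stage result
  runCandidate : ∀ {n} → Code (suc n) → Code (suc (suc (suc n)))
  runCandidate {n} f = compᶜ (runCode f) (projᶜ (# 2) ∷ projᶜ (# 0) ∷ restCodes 3 n)

  -- arguments (j ∷ a ∷ s ∷ xs), a = runMu at j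
  runMuStep : ∀ {n} → Code (suc n) → Code (suc (suc (suc n)))
  runMuStep f =
    compᶜ ifZeroCode (projᶜ (# 1)
      ∷ compᶜ ifZeroCode (runCandidate f ∷ oneCode
          ∷ compᶜ ifZeroCode (compᶜ predCode (runCandidate f ∷ [])
              ∷ compᶜ succᶜ (compᶜ succᶜ (projᶜ (# 0) ∷ []) ∷ []) ∷ zeroᶜ ∷ []) ∷ [])
      ∷ projᶜ (# 1) ∷ [])

mutual
  runCode-eval : ∀ {n} (c : Code n) s xs → Eval (runCode c) (s ∷ xs) (run c s xs)
  runCode-eval zeroᶜ s xs = ev-comp (ev-zero ∷ []) ev-succ
  runCode-eval succᶜ s (x ∷ []) = ev-comp (ev-comp (ev-proj ∷ []) ev-succ ∷ []) ev-succ
  runCode-eval (projᶜ i) s xs = ev-comp (ev-proj ∷ []) ev-succ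
  runCode-eval (compᶜ f gs) s xs =
    whenAllHalted-eval (runCodes-eval gs s xs)
      (ev-comp (ev-proj ∷ predCodes-eval (runCodes-eval gs s xs)) (runCode-eval f s (map pred (runAll gs s xs))))
  runCode-eval (precᶜ f g) s (k ∷ xs) =
    ev-comp (ev-proj ∷ ev-proj ∷ restCodes-eval 2 (s ∷ k ∷ []) xs) (runPrec-eval f g s xs k)
  runCode-eval (muᶜ f) s xs =
    ev-comp (ev-comp (ev-proj ∷ ev-proj ∷ restCodes-eval 1 (s ∷ []) xs) (runMu-eval f s xs s) ∷ []) (pred-eval _)

  runCodes-eval : ∀ {m n} (gs : Vec (Code n) m) s xs → EvalAll (runCodes gs) (s ∷ xs) (runAll gs s xs)
  runCodes-eval []       s xs = []
  runCodes-eval (g ∷ gs) s xs = runCode-eval g s xs ∷ runCodes-eval gs s xs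

  runPrec-eval : ∀ {n} (f : Code n) g s xs k → Eval (precᶜ (runCode f) (runPrecStep g)) (k ∷ s ∷ xs) (runPrec f g s xs k)
  runPrec-eval f g s xs zero    = ev-prec0 (runCode-eval f s xs)
  runPrec-eval f g s xs (suc k) = ev-precS (runPrec-eval f g s xs k)
    (ev-comp (ev-proj ∷ ev-zero
               ∷ ev-comp (ev-proj ∷ ev-proj ∷ ev-comp (ev-proj ∷ []) (pred-eval r) ∷ restCodes-eval 3 (k ∷ r ∷ s ∷ []) xs)
                         (runCode-eval g s (k ∷ pred r ∷ xs)) ∷ [])
             (ifZero-eval r 0 _))
    where r = runPrec f g s xs k

  runMu-eval : ∀ {n} (f : Code (suc n)) s xs j → Eval (precᶜ zeroᶜ (runMuStep f)) (j ∷ s ∷ xs) (runMu f s xs j)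
  runMu-eval f s xs zero    = ev-prec0 ev-zero
  runMu-eval f s xs (suc j) = ev-precS (runMu-eval f s xs j)
    (ev-comp (ev-proj
               ∷ ev-comp (candidate ∷ ev-comp (ev-zero ∷ []) ev-succ
                           ∷ ev-comp (ev-comp (candidate ∷ []) (pred-eval r)
                                       ∷ ev-comp (ev-comp (ev-proj ∷ []) ev-succ ∷ []) ev-succ ∷ ev-zero ∷ [])
                                     (ifZero-eval (pred r) _ 0) ∷ [])
                         (ifZero-eval r 1 _)
               ∷ ev-proj ∷ [])
             (ifZero-eval a _ a))
    where
      a = runMu f s xs j
      r = run f s (j ∷ xs)
      candidate : Eval (runCandidate f) (j ∷ a ∷ s ∷ xs) r
      candidate = ev-comp (ev-proj ∷ ev-proj ∷ restCodes-eval 3 (j ∷ a ∷ s ∷ []) xs) (runCode-eval f s (j ∷ xs))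

least-zero : (h : ℕ → ℕ) → ∀ b →
             (∀ k → k < b → ¬ h k ≡ 0) ⊎ (∃[ y ] (h y ≡ 0 × (∀ k → k < y → ¬ h k ≡ 0)))
least-zero h zero = inj₁ (λ k ())
least-zero h (suc b) with least-zero h b
... | inj₂ found = inj₂ found
... | inj₁ none-below with h b in hb
... | zero  = inj₂ (b , hb , none-below)
... | suc _ = inj₁ none-upto
  where
    none-upto : ∀ k → k < suc b → ¬ h k ≡ 0
    none-upto k k<1+b with m<1+n⇒m<n∨m≡n k<1+b
    ... | inj₁ k<b  = none-below k k<b
    ... | inj₂ refl = λ hk → 0≢1+n (trans (sym hk) hb)

mu-finds-zero : ∀ {n} (c : Code (suc n)) ps (h : ℕ → ℕ) → (∀ k → Eval c (k ∷ ps) (h k)) →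
                ∀ w → h w ≡ 0 → ∃[ y ] (Eval (muᶜ c) ps y × h y ≡ 0)
mu-finds-zero c ps h c-computes-h w hw with least-zero h (suc w)
... | inj₁ none = ⊥-elim (none w ≤-refl hw)
... | inj₂ (y , hy , positive-below) =
  y , ev-mu (subst (Eval c (y ∷ ps)) hy (c-computes-h y)) positive , hy
  where
    positive : ∀ k → k < y → ∃[ v ] Eval c (k ∷ ps) (suc v)
    positive k k<y with h k in hk | positive-below k k<y
    ... | zero  | ≢0 = ⊥-elim (≢0 refl)
    ... | suc v | _  = v , subst (Eval c (k ∷ ps)) hk (c-computes-h k)

record TotalFn (n : ℕ) : Set where
  constructor totalFn
  field
    code : Code n
    fn   : Vec ℕ n → ℕ
    eval : ∀ xs → Eval code xs (fn xs)
open TotalFn public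

codes : ∀ {m n} → Vec (TotalFn n) m → Vec (Code n) m
codes []       = []
codes (t ∷ ts) = code t ∷ codes ts

fns : ∀ {m n} → Vec (TotalFn n) m → Vec ℕ n → Vec ℕ m
fns []       xs = []
fns (t ∷ ts) xs = fn t xs ∷ fns ts xs

evals : ∀ {m n} (ts : Vec (TotalFn n) m) xs → EvalAll (codes ts) xs (fns ts xs)
evals []       xs = []
evals (t ∷ ts) xs = eval t xs ∷ evals ts xs

compose : ∀ {m n} → TotalFn m → Vec (TotalFn n) m → TotalFn n
compose f ts = totalFn (compᶜ (code f) (codes ts)) (λ xs → fn f (fns ts xs)) (λ xs → ev-comp (evals ts xs) (eval f _))

projection : ∀ {n} → Fin n → TotalFn n
projection i = totalFn (projᶜ i) (λ xs → lookup xs i) (λ xs → ev-proj)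

successor : TotalFn 1
successor = totalFn succᶜ (λ { (x ∷ []) → suc x }) (λ { (x ∷ []) → ev-succ })

constant : ∀ {n} → ℕ → TotalFn n
constant zero    = totalFn zeroᶜ (λ _ → 0) (λ _ → ev-zero)
constant (suc k) = compose successor (constant k ∷ [])

constant-fn : ∀ {n} k (xs : Vec ℕ n) → fn (constant k) xs ≡ k
constant-fn zero    xs = refl
constant-fn (suc k) xs = cong suc (constant-fn k xs)

primRecFn : ∀ {n} → (Vec ℕ n → ℕ) → (Vec ℕ (suc (suc n)) → ℕ) → ℕ → Vec ℕ n → ℕ
primRecFn F G zero    xs = F xs
primRecFn F G (suc k) xs = G (k ∷ primRecFn F G k xs ∷ xs)

primRec : ∀ {n} → TotalFn n → TotalFn (suc (suc n)) → TotalFn (suc n)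
primRec F G = totalFn (precᶜ (code F) (code G)) (λ { (k ∷ xs) → primRecFn (fn F) (fn G) k xs }) (λ { (k ∷ xs) → go k xs })
  where
    go : ∀ k xs → Eval (precᶜ (code F) (code G)) (k ∷ xs) (primRecFn (fn F) (fn G) k xs)
    go zero    xs = ev-prec0 (eval F xs)
    go (suc k) xs = ev-precS (go k xs) (eval G _)

ifZeroᵀ : TotalFn 3
ifZeroᵀ = totalFn ifZeroCode (λ { (c ∷ a ∷ b ∷ []) → ifZero c a b }) (λ { (c ∷ a ∷ b ∷ []) → ifZero-eval c a b })

predᵀ : TotalFn 1
predᵀ = totalFn predCode (λ { (x ∷ []) → pred x }) (λ { (x ∷ []) → pred-eval x })

runᵀ : Code 1 → TotalFn 2
runᵀ c = totalFn (runCode c) (λ { (s ∷ x ∷ []) → run c s (x ∷ []) }) (λ { (s ∷ x ∷ []) → runCode-eval c s (x ∷ []) })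

-- Tests are numbers read as truth values, 0 meaning true.
Holds : ℕ → Set
Holds r = r ≡ 0

halted : ℕ → ℕ
halted r = ifZero r 1 0

_∧ₜ_ : ℕ → ℕ → ℕ
r ∧ₜ s = ifZero r s 1

_∨ₜ_ : ℕ → ℕ → ℕ
r ∨ₜ s = ifZero r 0 s

_⇒ₜ_ : ℕ → ℕ → ℕ
r ⇒ₜ s = ifZero r s 0

infixr 7 _∧ₜ_
infixr 6 _∨ₜ_
infixr 5 _⇒ₜ_

halted-sound : ∀ r → Holds (halted r) → ∃[ v ] (r ≡ suc v)
halted-sound (suc v) _ = v , refl

halted-complete : ∀ {r v} → r ≡ suc v → Holds (halted r)
halted-complete refl = refl

∧-intro : ∀ {r s} → Holds r → Holds s → Holds (r ∧ₜ s)
∧-intro refl s = s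

∧-elim : ∀ r {s} → Holds (r ∧ₜ s) → Holds r × Holds s
∧-elim zero s = refl , s

∨-introˡ : ∀ {r} s → Holds r → Holds (r ∨ₜ s)
∨-introˡ s refl = refl

∨-introʳ : ∀ r {s} → Holds s → Holds (r ∨ₜ s)
∨-introʳ zero    s = refl
∨-introʳ (suc _) s = s

∨-elim : ∀ r {s} → Holds (r ∨ₜ s) → Holds r ⊎ Holds s
∨-elim zero    _ = inj₁ refl
∨-elim (suc _) s = inj₂ s

⇒-intro : ∀ r {s} → (Holds r → Holds s) → Holds (r ⇒ₜ s)
⇒-intro zero    h = h refl
⇒-intro (suc _) h = refl

⇒-elim : ∀ {r s} → Holds (r ⇒ₜ s) → Holds r → Holds s
⇒-elim s refl = s

haltedᵀ : TotalFn 1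
haltedᵀ = compose ifZeroᵀ (projection fzero ∷ constant 1 ∷ constant 0 ∷ [])

_∧ᵀ_ : ∀ {n} → TotalFn n → TotalFn n → TotalFn n
F ∧ᵀ G = compose ifZeroᵀ (F ∷ G ∷ constant 1 ∷ [])

_∨ᵀ_ : ∀ {n} → TotalFn n → TotalFn n → TotalFn n
F ∨ᵀ G = compose ifZeroᵀ (F ∷ constant 0 ∷ G ∷ [])

_⇒ᵀ_ : ∀ {n} → TotalFn n → TotalFn n → TotalFn n
F ⇒ᵀ G = compose ifZeroᵀ (F ∷ G ∷ constant 0 ∷ [])

infixr 7 _∧ᵀ_
infixr 6 _∨ᵀ_
infixr 5 _⇒ᵀ_

foldBelow : (ℕ → ℕ → ℕ) → ℕ → (ℕ → ℕ) → ℕ → ℕ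
foldBelow op e q zero    = e
foldBelow op e q (suc j) = op (foldBelow op e q j) (q j)

allBelow : (ℕ → ℕ) → ℕ → ℕ
allBelow = foldBelow _∧ₜ_ 0

anyBelow : (ℕ → ℕ) → ℕ → ℕ
anyBelow = foldBelow _∨ₜ_ 1

allBelow-intro : ∀ q j → (∀ n → n < j → Holds (q n)) → Holds (allBelow q j)
allBelow-intro q zero    h = refl
allBelow-intro q (suc j) h = ∧-intro (allBelow-intro q j (λ n n<j → h n (m<n⇒m<1+n n<j))) (h j ≤-refl)

allBelow-elim : ∀ q j → Holds (allBelow q j) → ∀ n → n < j → Holds (q n)
allBelow-elim q (suc j) all n n<1+j with ∧-elim (allBelow q j) all | m<1+n⇒m<n∨m≡n n<1+j
... | below , _ | inj₁ n<j  = allBelow-elim q j below n n<j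
... | _ , at-j  | inj₂ refl = at-j

anyBelow-intro : ∀ q j n → n < j → Holds (q n) → Holds (anyBelow q j)
anyBelow-intro q (suc j) n n<1+j qn with m<1+n⇒m<n∨m≡n n<1+j
... | inj₁ n<j  = ∨-introˡ (q j) (anyBelow-intro q j n n<j qn)
... | inj₂ refl = ∨-introʳ (anyBelow q j) qn

anyBelow-elim : ∀ q j → Holds (anyBelow q j) → ∃[ n ] (n < j × Holds (q n))
anyBelow-elim q (suc j) any with ∨-elim (anyBelow q j) any
... | inj₁ below = let n , n<j , qn = anyBelow-elim q j below in n , m<n⇒m<1+n n<j , qn
... | inj₂ at-j  = j , ≤-refl , at-j

foldBelowᵀ : ∀ {n} → TotalFn 2 → ℕ → TotalFn (suc n) → TotalFn (suc n)
foldBelowᵀ {n} Op e Q =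
  totalFn (precᶜ (code (constant e)) step)
          (λ { (j ∷ ps) → foldBelow (λ a b → fn Op (a ∷ b ∷ [])) e (λ a → fn Q (a ∷ ps)) j })
          (λ { (j ∷ ps) → go j ps })
  where
    -- arguments (j ∷ acc ∷ ps)
    step : Code (suc (suc n))
    step = compᶜ (code Op) (projᶜ (# 1) ∷ compᶜ (code Q) (projᶜ (# 0) ∷ restCodes 2 n) ∷ [])
    go : ∀ j ps → Eval (precᶜ (code (constant e)) step) (j ∷ ps)
                       (foldBelow (λ a b → fn Op (a ∷ b ∷ [])) e (λ a → fn Q (a ∷ ps)) j)
    go zero    ps = ev-prec0 (subst (Eval _ ps) (constant-fn e ps) (eval (constant e) ps))
    go (suc j) ps = ev-precS (go j ps)
      (ev-comp (ev-proj ∷ ev-comp (ev-proj ∷ restCodes-eval 2 (j ∷ _ ∷ []) ps) (eval Q _) ∷ []) (eval Op _))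

allBelowᵀ : ∀ {n} → TotalFn (suc n) → TotalFn (suc n)
allBelowᵀ = foldBelowᵀ (projection (# 0) ∧ᵀ projection (# 1)) 0

anyBelowᵀ : ∀ {n} → TotalFn (suc n) → TotalFn (suc n)
anyBelowᵀ = foldBelowᵀ (projection (# 0) ∨ᵀ projection (# 1)) 1

-- Unbounded search for a witness a of a test Q (a ∷ t ∷ ps) that holds at
-- some stage t: first the least stage t with a witness below t, then the
-- least witness at that stage.
search : ∀ {n} → TotalFn (suc (suc n)) → Code n
search {n} Q = muᶜ (compᶜ (code Q) (projᶜ (# 0) ∷ compᶜ (muᶜ witnessBelowStage) (restCodes 1 n) ∷ restCodes 1 n))
  where
    -- (t ∷ ps) ↦ anyBelow (λ a → Q (a ∷ t ∷ ps)) t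
    witnessBelowStage : Code (suc n)
    witnessBelowStage = compᶜ (code (anyBelowᵀ Q)) (projᶜ (# 0) ∷ projᶜ (# 0) ∷ restCodes 1 n)

search-finds : ∀ {n} (Q : TotalFn (suc (suc n))) ps a t → a < t → Holds (fn Q (a ∷ t ∷ ps)) →
               ∃[ v ] (Eval (search Q) ps v × ∃[ t′ ] Holds (fn Q (v ∷ t′ ∷ ps)))
search-finds {n} Q ps a t a<t holds
  with mu-finds-zero _ ps (λ t → anyBelow (λ a → fn Q (a ∷ t ∷ ps)) t)
         (λ t → ev-comp (ev-proj ∷ ev-proj ∷ restCodes-eval 1 (t ∷ []) ps) (eval (anyBelowᵀ Q) (t ∷ t ∷ ps)))
         t (anyBelow-intro _ t a a<t holds)
... | t* , stage-eval , witness-below with anyBelow-elim _ t* witness-below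
... | a* , _ , holds* with mu-finds-zero _ ps (λ a → fn Q (a ∷ t* ∷ ps))
                             (λ a → ev-comp (ev-proj ∷ ev-comp (restCodes-eval 1 (a ∷ []) ps) stage-eval
                                               ∷ restCodes-eval 1 (a ∷ []) ps)
                                             (eval Q _))
                             a* holds*
... | v , v-eval , holds-v = v , v-eval , t* , holds-v

search-unique : ∀ {n} (Q : TotalFn (suc (suc n))) ps a t → a < t → Holds (fn Q (a ∷ t ∷ ps)) →
                (∀ v t′ → Holds (fn Q (v ∷ t′ ∷ ps)) → v ≡ a) → Eval (search Q) ps a
search-unique Q ps a t a<t holds unique =
  let v , v-eval , t′ , holds-v = search-finds Q ps a t a<t holds
  in subst (Eval (search Q) ps) (unique v t′ holds-v) v-eval

-- Truncated subtraction, (b ∷ a ∷ []) ↦ a ∸ b.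
monusᵀ : TotalFn 2
monusᵀ = primRec (projection (# 0)) (compose predᵀ (projection (# 1) ∷ []))

monusᵀ-fn : ∀ b a → fn monusᵀ (b ∷ a ∷ []) ≡ a ∸ b
monusᵀ-fn zero    a = refl
monusᵀ-fn (suc b) a = trans (cong pred (monusᵀ-fn b a)) (pred[m∸n]≡m∸[1+n] a b)

equalᵀ : TotalFn 2
equalᵀ = compose monusᵀ (projection (# 1) ∷ projection (# 0) ∷ [])
      ∧ᵀ compose monusᵀ (projection (# 0) ∷ projection (# 1) ∷ [])

equalᵀ-fn : ∀ a b → fn equalᵀ (a ∷ b ∷ []) ≡ (a ∸ b) ∧ₜ (b ∸ a)
equalᵀ-fn a b = cong₂ _∧ₜ_ (monusᵀ-fn b a) (monusᵀ-fn a b)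

equalᵀ-sound : ∀ a b → Holds (fn equalᵀ (a ∷ b ∷ [])) → a ≡ b
equalᵀ-sound a b eq with ∧-elim (a ∸ b) (trans (sym (equalᵀ-fn a b)) eq)
... | a∸b≡0 , b∸a≡0 = ≤-antisym (m∸n≡0⇒m≤n a∸b≡0) (m∸n≡0⇒m≤n b∸a≡0)

equalᵀ-refl : ∀ a → Holds (fn equalᵀ (a ∷ a ∷ []))
equalᵀ-refl a = trans (equalᵀ-fn a a) (∧-intro (n∸n≡0 a) (n∸n≡0 a))

module Unpairing {pair : ℕ → ℕ → ℕ} (PC : IsComputablePairing pair) where
  open IsComputablePairing PC

  pairᵀ : TotalFn 2
  pairᵀ = totalFn (proj₁ computable) (λ { (a ∷ b ∷ []) → pair a b })
                  (λ { (a ∷ b ∷ []) → from (proj₂ computable a b (pair a b)) refl })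

  -- (a ∷ t ∷ z ∷ []): some b below t has ⟨a,b⟩ = z
  firstTest : TotalFn 3
  firstTest = compose (anyBelowᵀ (compose equalᵀ (compose pairᵀ (projection (# 1) ∷ projection (# 0) ∷ [])
                                                 ∷ projection (# 2) ∷ [])))
                      (projection (# 1) ∷ projection (# 0) ∷ projection (# 2) ∷ [])

  -- (b ∷ t ∷ z ∷ []): some a below t has ⟨a,b⟩ = z
  secondTest : TotalFn 3
  secondTest = compose (anyBelowᵀ (compose equalᵀ (compose pairᵀ (projection (# 0) ∷ projection (# 1) ∷ [])
                                                  ∷ projection (# 2) ∷ [])))
                       (projection (# 1) ∷ projection (# 0) ∷ projection (# 2) ∷ [])

  -- Opaque, so that evaluation derivations of codes built from the
  -- projections are matched without unfolding the searches.
  opaque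
    fstCode : Code 1
    fstCode = search firstTest

    sndCode : Code 1
    sndCode = search secondTest

    fst-eval : ∀ i n → Eval fstCode (pair i n ∷ []) i
    fst-eval i n =
      search-unique firstTest (pair i n ∷ []) i (suc (i ⊔ n)) (s≤s (m≤m⊔n i n))
        (anyBelow-intro _ (suc (i ⊔ n)) n (s≤s (m≤n⊔m i n)) (equalᵀ-refl (pair i n)))
        λ v t′ holds → let b , _ , b-pairs = anyBelow-elim _ t′ holds
                       in proj₁ (injective v b i n (equalᵀ-sound _ _ b-pairs))

    snd-eval : ∀ i n → Eval sndCode (pair i n ∷ []) n
    snd-eval i n =
      search-unique secondTest (pair i n ∷ []) n (suc (i ⊔ n)) (s≤s (m≤n⊔m i n))
        (anyBelow-intro _ (suc (i ⊔ n)) i (s≤s (m≤m⊔n i n)) (equalᵀ-refl (pair i n)))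
        λ v t′ holds → let a , _ , a-pairs = anyBelow-elim _ t′ holds
                       in proj₂ (injective a v i n (equalᵀ-sound _ _ a-pairs))

-- Enumerating a c.e. set of pairs in stages: `enteredᵀ (t ∷ a ∷ b ∷ [])`
-- holds once ⟨a,b⟩ has been enumerated by stage t.  This is sound, and
-- every member is eventually enumerated.
module PairStages {pair : ℕ → ℕ → ℕ} (PC : IsComputablePairing pair) {L : Pred ℕ 0ℓ} (L-ce : CE L) where
  open Unpairing PC using (pairᵀ)

  enteredᵀ : TotalFn 3
  enteredᵀ = compose haltedᵀ (compose (runᵀ (proj₁ L-ce))
                                      (projection (# 0) ∷ compose pairᵀ (projection (# 1) ∷ projection (# 2) ∷ []) ∷ [])
                              ∷ [])

  entered-sound : ∀ t a b → Holds (fn enteredᵀ (t ∷ a ∷ b ∷ [])) → L (pair a b)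
  entered-sound t a b holds =
    let v , halts = halted-sound _ holds in from (proj₂ L-ce (pair a b)) (v , run-sound _ t _ v halts)

  entered-eventually : ∀ a b → L (pair a b) → Eventually (λ t → Holds (fn enteredᵀ (t ∷ a ∷ b ∷ [])))
  entered-eventually a b member =
    let v , evaluates = to (proj₂ L-ce (pair a b)) member
        s₀ , halts = run-complete evaluates
    in s₀ , λ t s₀≤t → halted-complete (halts t s₀≤t)

module Numberings (φ : ℕ → ℕ → ℕ → Set) (pair : ℕ → ℕ → ℕ)
                  (T : Set) (B : ℕ → Pred T 0ℓ) (_≺_ : ℕ → ℕ → Set) where
  open Space φ pair T B _≺_

  limitPassing-≤ : ∀ {ν κ} → ν ≤ₙ κ → EffectiveLimitPassing ν → EffectiveLimitPassing κ
  limitPassing-≤ (g , g-reduces) (pt , pt-spec) = compᶜ g (pt ∷ []) , λ m y converges →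
    let v , pt-eval , v↦y = pt-spec m y converges
        k , g-eval , k↦y = g-reduces v y v↦y
    in k , ev-comp (pt-eval ∷ []) g-eval , k↦y

  -- Computability moves down along reducibility: ⟨i,n⟩ belongs to the new
  -- set iff ⟨h(i),n⟩ belongs to the old one, which is c.e. because the
  -- projections of the pairing are computable.
  computable-≤ : IsComputablePairing pair → ∀ {ν κ} → ν ≤ₙ κ → ComputableNumbering κ → ComputableNumbering ν
  computable-≤ PC {ν} (h , h-reduces) (L , (cL , cL-spec) , L-spec) =
    (λ z → ∃[ v ] Eval translated (z ∷ []) v) , (translated , λ _ → mk⇔ (λ z → z) (λ z → z)) , spec
    where
      open Unpairing PC
      open IsComputablePairing PC using (computable)

      translated : Code 1
      translated = compᶜ cL (compᶜ (code pairᵀ) (compᶜ h (fstCode ∷ []) ∷ sndCode ∷ []) ∷ [])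

      translated-eval : ∀ {i k} n → Eval h (i ∷ []) k → ∀ v →
                        Eval translated (pair i n ∷ []) v ⇔ Eval cL (pair k n ∷ []) v
      translated-eval {i} {k} n h-eval v = mk⇔ forward backward
        where
          forward : Eval translated (pair i n ∷ []) v → Eval cL (pair k n ∷ []) v
          forward (ev-comp (ev-comp (ev-comp (fst ∷ []) h′ ∷ snd ∷ []) pairs ∷ []) cL-eval)
            with eval-functional fst (fst-eval i n) | eval-functional snd (snd-eval i n)
          ... | refl | refl with eval-functional h′ h-eval
          ... | refl with to (proj₂ computable _ _ _) pairs
          ... | refl = cL-eval
          backward : Eval cL (pair k n ∷ []) v → Eval translated (pair i n ∷ []) v
          backward cL-eval =
            ev-comp (ev-comp (ev-comp (fst-eval i n ∷ []) h-eval ∷ snd-eval i n ∷ []) (eval pairᵀ (k ∷ n ∷ [])) ∷ []) cL-eval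

      spec : ∀ i y n → _↦_ ν i y → (∃[ v ] Eval translated (pair i n ∷ []) v) ⇔ B n y
      spec i y n i↦y with h-reduces i y i↦y
      ... | k , h-eval , k↦y = mk⇔
        (λ (v , e) → to (L-spec k y n k↦y) (from (cL-spec (pair k n)) (v , to (translated-eval n h-eval v) e)))
        (λ n∋y → let v , e = to (cL-spec (pair k n)) (from (L-spec k y n k↦y) n∋y)
                 in v , from (translated-eval n h-eval v) e)

  converges-if-eventually-below : (f : ℕ → ℕ) (y : T) → Normed f → (∀ k → B (f k) y) →
                                  (∀ m → B m y → Eventually (λ k → f k ≺ m)) → ConvergesTo f y
  converges-if-eventually-below f y normed contains below =
    normed ,
    (B (f 0) , 0 , (λ z → z) , (λ z → z)) ,
    (λ { U (a , U≈) → B (f a) , (λ z z∈ → f a , z∈ , λ w → w) , contains a , proj₂ U≈ }) ,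
    (λ { U (a , U≈) → f a , U≈ }) ,
    (λ { m n (a , m≈) (b , n≈) → below-both m n (proj₂ m≈ (contains a)) (proj₂ n≈ (contains b)) }) ,
    (λ { m (V , _ , y∈V , V⊆) → below-one m (V⊆ y∈V) })
    where
      enumerated : ∀ k → Enumerated f (B (f k))
      enumerated k = k , (λ z → z) , (λ z → z)

      below-both : ∀ m n → B m y → B n y → ∃[ a ] (Enumerated f (B a) × a ≺ m × a ≺ n)
      below-both m n m∋y n∋y with eventually-both (below m m∋y) (below n n∋y)
      ... | k , q = f k , enumerated k , q k ≤-refl

      below-one : ∀ m → B m y → ∃[ a ] (Enumerated f (B a) × a ≺ m)
      below-one m m∋y with below m m∋y
      ... | k , q = f k , enumerated k , q k ≤-refl

  -- For ν_i = y the sequence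
  -- f_i starts with a basic set seen to contain y, and f_i(k+1) is a basic
  -- set containing y that lies ≺-below f_i(k) and below every n < k seen to
  -- contain y by stage k.  The strong basis guarantees that such a set
  -- exists, and the stage enumerations of ν's set and of ≺ let `search`
  -- find one.
  module Reduction (GN : IsGödelNumbering φ) (PC : IsComputablePairing pair)
                   (covers : ∀ y → ∃[ n ] B n y) (≺-trans : Transitive≺)
                   (strong : IsStrongBasis) (≺-ce : ≺-CE) where
    module ConvergentNames (ν : Numbering T) (ν-computable : ComputableNumbering ν) where
      module Seen = PairStages PC (proj₁ (proj₂ ν-computable))
      module Related = PairStages PC (proj₁ (proj₂ ≺-ce))

      seen : ℕ → ℕ → ℕ → ℕ
      seen t i n = fn Seen.enteredᵀ (t ∷ i ∷ n ∷ [])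

      related : ℕ → ℕ → ℕ → ℕ
      related t a n = fn Related.enteredᵀ (t ∷ a ∷ n ∷ [])

      related-sound : ∀ t a n → Holds (related t a n) → a ≺ n
      related-sound t a n holds = to (proj₂ (proj₂ ≺-ce) a n) (Related.entered-sound t a n holds)

      related-eventually : ∀ a n → a ≺ n → Eventually (λ t → Holds (related t a n))
      related-eventually a n a≺n = Related.entered-eventually a n (from (proj₂ (proj₂ ≺-ce) a n) a≺n)

      -- The tests are opaque and used through their `-fn` equations, which
      -- keeps the normal forms that the type checker meets small.
      opaque
        -- (a ∷ t ∷ i ∷ []): a is seen for i by stage t
        startTest : TotalFn 3
        startTest = compose Seen.enteredᵀ (projection (# 1) ∷ projection (# 2) ∷ projection (# 0) ∷ [])

        -- (n ∷ a ∷ t ∷ k ∷ p ∷ i ∷ []): if n is seen for i by stage k, then a ≺ n by stage t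
        guard : TotalFn 6
        guard = compose Seen.enteredᵀ (projection (# 3) ∷ projection (# 5) ∷ projection (# 0) ∷ [])
             ⇒ᵀ compose Related.enteredᵀ (projection (# 2) ∷ projection (# 1) ∷ projection (# 0) ∷ [])

        -- (a ∷ t ∷ k ∷ p ∷ i ∷ []): the guard holds for all n < k, and by stage t
        -- a is seen for i and a ≺ p
        stepTest : TotalFn 5
        stepTest = compose Seen.enteredᵀ (projection (# 1) ∷ projection (# 4) ∷ projection (# 0) ∷ [])
                ∧ᵀ compose Related.enteredᵀ (projection (# 1) ∷ projection (# 0) ∷ projection (# 3) ∷ [])
                ∧ᵀ compose (allBelowᵀ guard)
                           (projection (# 2) ∷ projection (# 0) ∷ projection (# 1)
                            ∷ projection (# 2) ∷ projection (# 3) ∷ projection (# 4) ∷ [])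

        stepTest-fn : ∀ a t k p i → fn stepTest (a ∷ t ∷ k ∷ p ∷ i ∷ [])
                                  ≡ seen t i a ∧ₜ related t a p ∧ₜ allBelow (λ n → seen k i n ⇒ₜ related t a n) k
        stepTest-fn a t k p i = refl

        startTest-fn : ∀ a t i → fn startTest (a ∷ t ∷ i ∷ []) ≡ seen t i a
        startTest-fn a t i = refl

      -- (k ∷ i ∷ []) ↦ f_i(k)
      sequenceCode : Code 2
      sequenceCode = precᶜ (search startTest) (search stepTest)

      module Point {i : ℕ} {y : T} (i↦y : _↦_ ν i y) where
        seen-sound : ∀ t n → Holds (seen t i n) → B n y
        seen-sound t n holds = to (proj₂ (proj₂ ν-computable) i y n i↦y) (Seen.entered-sound t i n holds)

        seen-eventually : ∀ n → B n y → Eventually (λ t → Holds (seen t i n))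
        seen-eventually n n∋y = Seen.entered-eventually i n (from (proj₂ (proj₂ ν-computable) i y n i↦y) n∋y)

        BelowSeen : ℕ → ℕ → ℕ → Set
        BelowSeen k j a = ∀ n → n < j → Holds (seen k i n) → a ≺ n

        -- a is an admissible value of f_i(k+1) when f_i(k) = p
        Candidate : ℕ → ℕ → ℕ → Set
        Candidate k p a = B a y × a ≺ p × BelowSeen k k a

        -- Candidates exist: refine p by the strong basis property, one seen set at a time.
        refine : ∀ k p → B p y → ∀ j → ∃[ a ] (B a y × a ≺ p × BelowSeen k j a)
        refine k p p∋y zero with strong y p p p∋y p∋y
        ... | a , a∋y , a≺p , _ = a , a∋y , a≺p , λ n ()
        refine k p p∋y (suc j) with refine k p p∋y j | seen k i j ≟ 0
        ... | a , a∋y , a≺p , below | no unseen = a , a∋y , a≺p , below′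
          where
            below′ : BelowSeen k (suc j) a
            below′ n n<1+j seen-n with m<1+n⇒m<n∨m≡n n<1+j
            ... | inj₁ n<j  = below n n<j seen-n
            ... | inj₂ refl = ⊥-elim (unseen seen-n)
        ... | a , a∋y , a≺p , below | yes seen-j with strong y a j a∋y (seen-sound k j seen-j)
        ...   | a′ , a′∋y , a′≺a , a′≺j = a′ , a′∋y , ≺-trans a′≺a a≺p , below′
          where
            below′ : BelowSeen k (suc j) a′
            below′ n n<1+j seen-n with m<1+n⇒m<n∨m≡n n<1+j
            ... | inj₁ n<j  = ≺-trans a′≺a (below n n<j seen-n)
            ... | inj₂ refl = a′≺j

        stepTest-sound : ∀ a t k p → Holds (fn stepTest (a ∷ t ∷ k ∷ p ∷ i ∷ [])) → Candidate k p a
        stepTest-sound a t k p holds with ∧-elim (seen t i a) (trans (sym (stepTest-fn a t k p i)) holds)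
        ... | seen-a , rest with ∧-elim (related t a p) rest
        ... | a≺p , guards =
          seen-sound t a seen-a , related-sound t a p a≺p ,
          λ n n<k seen-n → related-sound t a n (⇒-elim (allBelow-elim _ k guards n n<k) seen-n)

        stepTest-eventually : ∀ a k p → Candidate k p a → Eventually (λ t → Holds (fn stepTest (a ∷ t ∷ k ∷ p ∷ i ∷ [])))
        stepTest-eventually a k p (a∋y , a≺p , below)
          with eventually-both (seen-eventually a a∋y)
                 (eventually-both (related-eventually a p a≺p)
                                  (eventually-below (λ n t → Holds (seen k i n ⇒ₜ related t a n)) k guard-eventually))
          where
            guard-eventually : ∀ n → n < k → Eventually (λ t → Holds (seen k i n ⇒ₜ related t a n))
            guard-eventually n n<k with seen k i n ≟ 0
            ... | yes seen-n = let t₀ , q = related-eventually a n (below n n<k seen-n)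
                               in t₀ , λ t t₀≤t → ⇒-intro (seen k i n) (λ _ → q t t₀≤t)
            ... | no unseen  = 0 , λ t _ → ⇒-intro (seen k i n) (λ seen-n → ⊥-elim (unseen seen-n))
        ... | t₀ , q = t₀ , λ t t₀≤t → let seen-a , a≺p , guards = q t t₀≤t in
          trans (stepTest-fn a t k p i) (∧-intro seen-a (∧-intro a≺p (allBelow-intro _ k guards)))

        -- The searches for f_i(0) and f_i(k+1) succeed.  Opaque: f is defined
        -- through these, and comparing its values must not unfold the searches.
        opaque
          nextStep : ∀ k p → B p y → Σ ℕ λ v → Eval (search stepTest) (k ∷ p ∷ i ∷ []) v × Candidate k p v
          nextStep k p p∋y =
            let a , candidate = refine k p p∋y k
                t₀ , q = stepTest-eventually a k p candidate
                v , v-eval , t′ , holds = search-finds stepTest (k ∷ p ∷ i ∷ []) a (t₀ ⊔ suc a) (m≤n⊔m t₀ (suc a))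
                                                       (q (t₀ ⊔ suc a) (m≤m⊔n t₀ (suc a)))
            in v , v-eval , stepTest-sound v t′ k p holds

          firstStep : Σ ℕ λ v → Eval (search startTest) (i ∷ []) v × B v y
          firstStep =
            let n , n∋y = covers y
                t₀ , q = seen-eventually n n∋y
                v , v-eval , t′ , holds = search-finds startTest (i ∷ []) n (t₀ ⊔ suc n) (m≤n⊔m t₀ (suc n))
                                                       (trans (startTest-fn n _ i) (q (t₀ ⊔ suc n) (m≤m⊔n t₀ (suc n))))
            in v , v-eval , seen-sound t′ v (trans (sym (startTest-fn v t′ i)) holds)

        sequence : ∀ k → Σ ℕ λ v → Eval sequenceCode (k ∷ i ∷ []) v × B v y
        sequence zero = let v , v-eval , v∋y = firstStep in v , ev-prec0 v-eval , v∋y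
        sequence (suc k) =
          let p , p-eval , p∋y = sequence k
              v , v-eval , v∋y , _ = nextStep k p p∋y
          in v , ev-precS p-eval v-eval , v∋y

        f : ℕ → ℕ
        f k = proj₁ (sequence k)

        contains : ∀ k → B (f k) y
        contains k = proj₂ (proj₂ (sequence k))

        step : ∀ k → Candidate k (f k) (f (suc k))
        step k = proj₂ (proj₂ (nextStep k (f k) (contains k)))

        -- Every basic neighbourhood m of y is seen at some stage t₀, so f(k+1)
        -- lies below it once k > m and k ≥ t₀.
        eventually-below-nbhd : ∀ m → B m y → Eventually (λ k → f k ≺ m)
        eventually-below-nbhd m m∋y with seen-eventually m m∋y
        ... | t₀ , q = suc (suc m ⊔ t₀) , λ where
          (suc k) 2+m⊔t₀≤1+k → let m⊔t₀≤k = s≤s⁻¹ 2+m⊔t₀≤1+k in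
            proj₂ (proj₂ (step k)) m (≤-trans (m≤m⊔n (suc m) t₀) m⊔t₀≤k)
                                     (q k (≤-trans (m≤n⊔m (suc m) t₀) m⊔t₀≤k))

        converges : ConvergesTo f y
        converges = converges-if-eventually-below f y (λ k → proj₁ (proj₂ (step k))) contains eventually-below-nbhd

      sequenceCodeᵢ : Code 2
      sequenceCodeᵢ = compᶜ sequenceCode (projᶜ (# 1) ∷ projᶜ (# 0) ∷ [])

      indexCode : Code 1
      indexCode = proj₁ (IsGödelNumbering.smn GN sequenceCodeᵢ)

      index-converges : ∀ {i y} → _↦_ ν i y → ∃[ j ] (Eval indexCode (i ∷ []) j × IndexOfConvergent j y)
      index-converges {i} {y} i↦y with proj₂ (IsGödelNumbering.smn GN sequenceCodeᵢ) i
      ... | j , j-eval , φj = j , j-eval , f , φj-computes-f , converges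
        where
          open Point i↦y using (f; sequence; converges)
          f-eval : ∀ a → Eval sequenceCodeᵢ (i ∷ a ∷ []) (f a)
          f-eval a = ev-comp (ev-proj ∷ ev-proj ∷ []) (proj₁ (proj₂ (sequence a)))
          φj-computes-f : ∀ a v → φ j a v ⇔ (f a ≡ v)
          φj-computes-f a v = mk⇔ (λ φjav → eval-functional (f-eval a) (to (φj a v) φjav))
                                  (λ { refl → from (φj a (f a)) (f-eval a) })

    computable≤limitPassing : ∀ {ν κ} → ComputableNumbering ν → EffectiveLimitPassing κ → ν ≤ₙ κ
    computable≤limitPassing {ν} ν-computable (pt , pt-spec) =
      compᶜ pt (indexCode ∷ []) , λ i y i↦y →
        let j , j-eval , j-converges = index-converges i↦y
            v , pt-eval , v↦y = pt-spec j y j-converges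
        in v , ev-comp (j-eval ∷ []) pt-eval , v↦y
      where open ConvergentNames ν ν-computable

corollary3p10 : (φ : ℕ → ℕ → ℕ → Set) → IsGödelNumbering φ →
    (pair : ℕ → ℕ → ℕ) → IsComputablePairing pair →
    (T : Set) → Countable T →
    (B : ℕ → Pred T 0ℓ) → (_≺_ : ℕ → ℕ → Set) →
    Space.IsBasis φ pair T B _≺_ →
    Space.IsT0 φ pair T B _≺_ →
    Space.IsStrongInclusion φ pair T B _≺_ →
    Space.IsStrongBasis φ pair T B _≺_ →
    Space.≺-CE φ pair T B _≺_ →
    (x : Numbering T) → Space.Acceptable φ pair T B _≺_ x →
    (x′ : Numbering T) →
    Space.Acceptable φ pair T B _≺_ x′ ⇔ Equivalent x x′
corollary3p10 φ GN pair PC T _ B _≺_ (covers , _) _ (≺-trans , _) strong ≺-ce x (x-computable , x-limits) x′ =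
  mk⇔ (λ (x′-computable , x′-limits) →
         computable≤limitPassing {x} {x′} x-computable x′-limits ,
         computable≤limitPassing {x′} {x} x′-computable x-limits)
      (λ (x≤x′ , x′≤x) → computable-≤ PC {x′} {x} x′≤x x-computable , limitPassing-≤ {x} {x′} x≤x′ x-limits)
  where
    open Numberings φ pair T B _≺_
    open Reduction GN PC covers ≺-trans strong ≺-ce
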